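{- $\mathsf{KDT}$ is parallelizable, i.e., $\widehat{\mathsf{KDT}} \leq_W \mathsf{KDT}$.
   Context: Problems are (possibly partial) multivalued functions between represented spaces. $P\leq_W Q$: there are computable partial $\Phi,\Psi:\subseteq\mathbb{N}^\mathbb{N}\to\mathbb{N}^\mathbb{N}$ such that for each name $p$ of a $P$-instance, $\Phi(p)$ names a $Q$-instance, and for each name $q$ of a $Q$-solution to it, $\Psi(p\oplus q)$ names a $P$-solution of $p$. The parallelization $\widehat{P}$ has domain $\mathrm{dom}(P)^\mathbb{N}$ and $\widehat{P}((x_n)_n)=\{(y_n)_n: y_n\in P(x_n)\text{ for all }n\}$. $\mathsf{KDT}$: given a countable bipartite graph $G$ (represented by its vertex set and edge relation), produce a König cover $(C,M)$: $M$ a matching (pairwise vertex-disjoint edges) and $C$ a vertex cover obtained by choosing exactly one vertex from each edge of $M$. -}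

module Defs where

open import Data.Nat using (ℕ; zero; suc; _+_; _*_; _<_)
open import Data.Fin using (Fin)
open import Data.Vec using (Vec; []; _∷_; lookup)
open import Data.Bool using (Bool)
open import Data.Product using (Σ; ∃; _×_; _,_)
open import Data.Sum using (_⊎_)
open import Relation.Binary.PropositionalEquality using (_≡_; _≢_)
open import Relation.Nullary using (¬_)

Baire : Set
Baire = ℕ → ℕ

tri : ℕ → ℕ
tri zero    = zero
tri (suc n) = suc n + tri n

⟨_,_⟩ : ℕ → ℕ → ℕ
⟨ a , b ⟩ = tri (a + b) + b

-- p ⊕ q : (p ⊕ q)(2n) = p n,  (p ⊕ q)(2n+1) = q n
_⊕_ : Baire → Baire → Baire
(p ⊕ q) zero          = p zero
(p ⊕ q) (suc zero)    = q zero
(p ⊕ q) (suc (suc n)) = ((λ k → p (suc k)) ⊕ (λ k → q (suc k))) n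

component : Baire → ℕ → Baire
component p i k = p ⟨ i , k ⟩

-- Type-2 computability: partial recursive functionals with an oracle
-- p : Baire (Kleene's schemes relativised to the oracle p).

data Code : ℕ → Set where
  zer  : ∀ {n} → Code n
  succ : Code 1
  proj : ∀ {n} → Fin n → Code n
  orc  : Code 1
  comp : ∀ {m n} → Code m → Vec (Code n) m → Code n
  prec : ∀ {n} → Code n → Code (suc (suc n)) → Code (suc n)
  mu   : ∀ {n} → Code (suc n) → Code n

mutual
  data Eval (p : Baire) : ∀ {n} → Code n → Vec ℕ n → ℕ → Set where
    e-zer  : ∀ {n} {xs : Vec ℕ n} → Eval p zer xs 0
    e-succ : ∀ {x} → Eval p succ (x ∷ []) (suc x)
    e-proj : ∀ {n} {i : Fin n} {xs} → Eval p (proj i) xs (lookup xs i)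
    e-orc  : ∀ {x} → Eval p orc (x ∷ []) (p x)
    e-comp : ∀ {m n} {f : Code m} {gs : Vec (Code n) m} {xs ys v} →
             EvalAll p gs xs ys → Eval p f ys v → Eval p (comp f gs) xs v
    e-prec0 : ∀ {n} {f : Code n} {g : Code (suc (suc n))} {xs v} →
             Eval p f xs v → Eval p (prec f g) (0 ∷ xs) v
    e-precS : ∀ {n} {f : Code n} {g : Code (suc (suc n))} {k xs r v} →
             Eval p (prec f g) (k ∷ xs) r → Eval p g (k ∷ r ∷ xs) v →
             Eval p (prec f g) (suc k ∷ xs) v
    e-mu   : ∀ {n} {f : Code (suc n)} {xs k} →
             Eval p f (k ∷ xs) 0 →
             (∀ j → j < k → ∃ λ m → Eval p f (j ∷ xs) (suc m)) →
             Eval p (mu f) xs k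

  data EvalAll (p : Baire) {n : ℕ} : ∀ {m} → Vec (Code n) m → Vec ℕ n → Vec ℕ m → Set where
    []  : ∀ {xs} → EvalAll p [] xs []
    _∷_ : ∀ {m} {g : Code n} {gs : Vec (Code n) m} {xs y ys} →
          Eval p g xs y → EvalAll p gs xs ys → EvalAll p (g ∷ gs) xs (y ∷ ys)

-- The computable partial map Φ_e : ⊆ Baire → Baire given by e is defined
-- at p with value r
Computes : Code 1 → Baire → Baire → Set
Computes e p r = ∀ n → Eval p e (n ∷ []) (r n)

record Problem : Set₁ where
  field
    Inst : Baire → Set            -- p is a name of an instance in dom(P)
    Sol  : Baire → Baire → Set    -- q is a name of a solution of (the instance named by) p

open Problem public

_≤W_ : Problem → Problem → Set
P ≤W Q = Σ (Code 1) λ Φ → Σ (Code 1) λ Ψ →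
  ∀ p → Inst P p →
    Σ Baire λ r → Computes Φ p r × Inst Q r ×
      (∀ q → Sol Q r q →
         Σ Baire λ s → Computes Ψ (p ⊕ q) s × Sol P p s)

parallel : Problem → Problem
parallel P = record
  { Inst = λ p → ∀ i → Inst P (component p i)
  ; Sol  = λ p q → ∀ i → Sol P (component p i) (component q i)
  }

-- Sets coded by characteristic functions: k ∈ set iff value is 1.
-- A name of a graph is χ_V ⊕ χ_E, with E a set of codes ⟨u,v⟩.

InV : Baire → ℕ → Set
InV p v = p (2 * v) ≡ 1

InE : Baire → ℕ → ℕ → Set
InE p u v = p (suc (2 * ⟨ u , v ⟩)) ≡ 1

IsBipartiteGraph : Baire → Set
IsBipartiteGraph p =
  (∀ u v → InE p u v → InV p u × InV p v) ×
  (∀ u v → InE p u v → InE p v u) ×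
  (Σ (ℕ → Bool) λ col → ∀ u v → InE p u v → col u ≢ col v)

-- q = χ_C ⊕ χ_M names a König cover (C,M) of the graph named by p
IsKonigCover : Baire → Baire → Set
IsKonigCover p q =
  (∀ u v → InE q u v → InE p u v) ×
  (∀ u v → InE q u v → InE q v u) ×
  (∀ u v w → InE q u v → InE q u w → v ≡ w) ×
  -- C picks exactly one vertex from each edge of M ...
  (∀ u v → InE q u v → (InV q u × ¬ InV q v) ⊎ (¬ InV q u × InV q v)) ×
  -- ... and consists only of such chosen vertices
  (∀ c → InV q c → ∃ λ v → InE q c v) ×
  (∀ u v → InE p u v → InV q u ⊎ InV q v)

KDT : Problem
KDT = record { Inst = IsBipartiteGraph ; Sol = IsKonigCover }

module Submission where

-- KDT is parallelizable: a sequence of bipartite graphs (G_i)_i is reduced to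
-- the single bipartite graph ⊔_i G_i, their disjoint union, whose vertex ⟨i,v⟩
-- is the vertex v of G_i (⟨_,_⟩ the Cantor pairing) and whose edges join ⟨i,a⟩
-- and ⟨i,b⟩ exactly when a and b are adjacent in G_i.  A König cover of the
-- union restricts to a König cover of every summand, since matching edges and
-- covering vertices never cross between summands.

open import Defs
open import Data.Nat using (ℕ; zero; suc; pred; _+_; _*_; _∸_; _≤_; _<_; z≤n; s≤s; z<s; s≤s⁻¹; _≤?_)
open import Data.Nat.Properties
open import Data.Fin using (Fin) renaming (zero to #0; suc to #suc)
open import Data.Vec using (Vec; []; _∷_; lookup; head; tail)
open import Data.Product using (Σ; ∃; _×_; _,_; proj₁; proj₂)
open import Data.Sum using (_⊎_; inj₁; inj₂)
open import Data.Bool using (Bool)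
open import Relation.Binary.PropositionalEquality
open import Relation.Nullary using (¬_; yes; no; contradiction)

Computable : (n : ℕ) → (Baire → Vec ℕ n → ℕ) → Set
Computable n F = Σ (Code n) λ c → ∀ p xs → Eval p c xs (F p xs)

-- Unary (oracle-dependent) and binary functions, in the form in which
-- composition of computable functions is definitionally a composition.
Computable₁ : (Baire → ℕ → ℕ) → Set
Computable₁ f = Computable 1 (λ p xs → f p (head xs))

Computable₂ : (ℕ → ℕ → ℕ) → Set
Computable₂ f = Computable 2 (λ _ xs → f (head xs) (head (tail xs)))

computes : ∀ f (c : Computable₁ f) p → Computes (proj₁ c) p (f p)
computes f (c , ok) p n = ok p (n ∷ [])

computable-ext : ∀ {n F G} → Computable n F → (∀ p xs → F p xs ≡ G p xs) → Computable n G
computable-ext (c , ok) eq = c , λ p xs → subst (Eval p c xs) (eq p xs) (ok p xs)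

projection : ∀ {n} (i : Fin n) → Computable n (λ _ xs → lookup xs i)
projection i = proj i , λ _ _ → e-proj

successor : Computable₁ (λ _ x → suc x)
successor = succ , λ { _ (x ∷ []) → e-succ }

oracle : Computable₁ (λ p x → p x)
oracle = orc , λ { _ (x ∷ []) → e-orc }

compose₁ : ∀ {n F G} → Computable 1 F → Computable n G →
           Computable n (λ p xs → F p (G p xs ∷ []))
compose₁ (f , okf) (g , okg) = comp f (g ∷ []) , λ p xs → e-comp (okg p xs ∷ []) (okf p _)

compose₂ : ∀ {n F G H} → Computable 2 F → Computable n G → Computable n H →
           Computable n (λ p xs → F p (G p xs ∷ H p xs ∷ []))
compose₂ (f , okf) (g , okg) (h , okh) =
  comp f (g ∷ h ∷ []) , λ p xs → e-comp (okg p xs ∷ okh p xs ∷ []) (okf p _)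

constant : ∀ {n} k → Computable n (λ _ _ → k)
constant zero    = zer , λ _ _ → e-zer
constant (suc k) = compose₁ successor (constant k)

identity : Computable₁ (λ _ x → x)
identity = computable-ext (projection #0) λ { _ (x ∷ []) → refl }

first : Computable₂ (λ x _ → x)
first = computable-ext (projection #0) λ { _ (x ∷ y ∷ []) → refl }

second : Computable₂ (λ _ y → y)
second = computable-ext (projection (#suc #0)) λ { _ (x ∷ y ∷ []) → refl }

recursion : ∀ {n} {F : Baire → Vec ℕ n → ℕ} {G : Baire → Vec ℕ (suc (suc n)) → ℕ}
  (f : ℕ → Vec ℕ n → ℕ) → Computable n F → Computable (suc (suc n)) G →
  (∀ p xs → f 0 xs ≡ F p xs) → (∀ p k xs → f (suc k) xs ≡ G p (k ∷ f k xs ∷ xs)) →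
  Computable (suc n) (λ _ xs → f (head xs) (tail xs))
recursion f (cF , okF) (cG , okG) base step = prec cF cG , ok
  where
  ok : ∀ p xs → Eval p (prec cF cG) xs (f (head xs) (tail xs))
  ok p (zero ∷ xs) =
    subst (Eval p (prec cF cG) (zero ∷ xs)) (sym (base p xs)) (e-prec0 (okF p xs))
  ok p (suc k ∷ xs) =
    subst (Eval p (prec cF cG) (suc k ∷ xs)) (sym (step p k xs))
          (e-precS (ok p (k ∷ xs)) (okG p (k ∷ f k xs ∷ xs)))

recursion₁ : (f : ℕ → ℕ) (a : ℕ) (g : ℕ → ℕ → ℕ) → Computable₂ g →
             f 0 ≡ a → (∀ k → f (suc k) ≡ g k (f k)) → Computable₁ (λ _ → f)
recursion₁ f a g cg base step =
  recursion (λ k _ → f k) (constant a) cg (λ _ _ → base) (λ _ k _ → step k)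

recursion₂ : ∀ {a} (f : ℕ → ℕ → ℕ) → Computable₁ (λ _ → a) → (h : ℕ → ℕ → ℕ) → Computable₂ h →
             (∀ y → f 0 y ≡ a y) → (∀ k y → f (suc k) y ≡ h (f k y) y) → Computable₂ f
recursion₂ f a h ch base step =
  recursion (λ k ys → f k (head ys)) a (compose₂ ch (projection (#suc #0)) (projection (#suc (#suc #0))))
            (λ { _ (y ∷ []) → base y }) (λ { _ k (y ∷ []) → step k y })

predecessor : Computable₁ (λ _ → pred)
predecessor = recursion₁ pred 0 (λ k _ → k) first refl λ _ → refl

addition : Computable₂ _+_
addition = recursion₂ _+_ identity (λ r _ → suc r) (compose₁ successor first) (λ _ → refl) λ _ _ → refl

subtraction : Computable₂ _∸_
subtraction = compose₂ subtracted second first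
  where
  subtracted : Computable₂ (λ k y → y ∸ k)
  subtracted = recursion₂ (λ k y → y ∸ k) identity (λ r _ → pred r) (compose₁ predecessor first)
                 (λ _ → refl) λ k y → sym (pred[m∸n]≡m∸[1+n] y k)

multiplication : Computable₂ _*_
multiplication = recursion₂ _*_ (constant 0) (λ r y → y + r) (compose₂ addition second first) (λ _ → refl) λ _ _ → refl

doubling : Computable₁ (λ _ x → 2 * x)
doubling = compose₂ multiplication (constant 2) identity

triangular : Computable₁ (λ _ → tri)
triangular = recursion₁ tri 0 (λ k r → suc k + r) (compose₂ addition (compose₁ successor first) second) refl λ _ → refl

pairing : Computable₂ ⟨_,_⟩
pairing = compose₂ addition (compose₁ triangular (compose₂ addition first second)) second

-- Parity and halving read the two interleaved halves of a name p ⊕ q.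
par : ℕ → ℕ
par zero    = 0
par (suc k) = 1 ∸ par k

half : ℕ → ℕ
half zero    = 0
half (suc k) = half k + par k

parity : Computable₁ (λ _ → par)
parity = recursion₁ par 0 (λ _ r → 1 ∸ r) (compose₂ subtraction (constant 1) second) refl λ _ → refl

halving : Computable₁ (λ _ → half)
halving = recursion₁ half 0 (λ k r → r + par k) (compose₂ addition second (compose₁ parity first)) refl λ _ → refl

par-even : ∀ n → par (2 * n) ≡ 0
par-even zero = refl
par-even (suc n) = begin
  par (2 * suc n)          ≡⟨ cong par (*-suc 2 n) ⟩
  1 ∸ (1 ∸ par (2 * n))    ≡⟨ cong (λ b → 1 ∸ (1 ∸ b)) (par-even n) ⟩
  0                        ∎
  where open ≡-Reasoning

par-odd : ∀ n → par (suc (2 * n)) ≡ 1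
par-odd n rewrite par-even n = refl

half-even : ∀ n → half (2 * n) ≡ n
half-even zero = refl
half-even (suc n) = begin
  half (2 * suc n)                                   ≡⟨ cong half (*-suc 2 n) ⟩
  half (2 * n) + par (2 * n) + (1 ∸ par (2 * n))     ≡⟨ cong₂ (λ h b → h + b + (1 ∸ b)) (half-even n) (par-even n) ⟩
  n + 0 + 1                                          ≡⟨ +-comm (n + 0) 1 ⟩
  suc (n + 0)                                        ≡⟨ cong suc (+-identityʳ n) ⟩
  suc n                                              ∎
  where open ≡-Reasoning

half-odd : ∀ n → half (suc (2 * n)) ≡ n
half-odd n rewrite half-even n | par-even n = +-identityʳ n

⊕-odd : ∀ p q n → (p ⊕ q) (suc (2 * n)) ≡ q n
⊕-odd p q zero = refl
⊕-odd p q (suc n) =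
  trans (cong (λ m → (p ⊕ q) (suc m)) (*-suc 2 n)) (⊕-odd (λ k → p (suc k)) (λ k → q (suc k)) n)

-- `select b x y` is x when b = 0 and y when b = 1 (a computable case split).
select : ℕ → ℕ → ℕ → ℕ
select b x y = (1 ∸ b) * x + b * y

select-0 : ∀ x y → select 0 x y ≡ x
select-0 x y rewrite +-identityʳ x = +-identityʳ x

select-1 : ∀ x y → select 1 x y ≡ y
select-1 x y = +-identityʳ y

selection : ∀ {n B X Y} → Computable n B → Computable n X → Computable n Y →
            Computable n (λ p xs → select (B p xs) (X p xs) (Y p xs))
selection b x y = compose₂ addition (compose₂ multiplication (compose₂ subtraction (constant 1) b) x)
                                    (compose₂ multiplication b y)

isLe : ℕ → ℕ → ℕ
isLe x y = 1 ∸ (x ∸ y)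

isEq : ℕ → ℕ → ℕ
isEq x y = 1 ∸ ((x ∸ y) + (y ∸ x))

isLe-computable : Computable₂ isLe
isLe-computable = compose₂ subtraction (constant 1) subtraction

isEq-computable : Computable₂ isEq
isEq-computable = compose₂ subtraction (constant 1)
  (compose₂ addition subtraction (compose₂ subtraction second first))

isLe-≤ : ∀ {x y} → x ≤ y → isLe x y ≡ 1
isLe-≤ {zero}  {y}     _       = cong (1 ∸_) (0∸n≡0 y)
isLe-≤ {suc x} {suc y} (s≤s h) = isLe-≤ h

isLe-> : ∀ {x y} → y < x → isLe x y ≡ 0
isLe-> {suc x} {zero}  _       = 0∸n≡0 x
isLe-> {suc x} {suc y} (s≤s h) = isLe-> h

isEq-refl : ∀ x → isEq x x ≡ 1
isEq-refl zero    = refl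
isEq-refl (suc x) = isEq-refl x

isEq-sound : ∀ x y → isEq x y ≡ 1 → x ≡ y
isEq-sound zero    zero    _ = refl
isEq-sound zero    (suc y) h = contradiction (trans (sym (0∸n≡0 y)) h) λ ()
isEq-sound (suc x) zero    h = contradiction (trans (sym (0∸n≡0 (x + 0))) h) λ ()
isEq-sound (suc x) (suc y) h = cong suc (isEq-sound x y h)

guarded-sound : ∀ x y b → isEq x y * b ≡ 1 → x ≡ y × b ≡ 1
guarded-sound x y b h = isEq-sound x y (m*n≡1⇒m≡1 _ b h) , m*n≡1⇒n≡1 (isEq x y) b h

guarded-complete : ∀ x b → b ≡ 1 → isEq x x * b ≡ 1
guarded-complete x b h rewrite isEq-refl x | h = refl

-- Inverting the Cantor pairing.  n lies on the d-th diagonal when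
-- tri d ≤ n < tri (d + 1); `diag n` finds that diagonal by recursion on n.
OnDiagonal : ℕ → ℕ → Set
OnDiagonal d n = tri d ≤ n × n < tri (suc d)

diag : ℕ → ℕ
diag zero    = zero
diag (suc k) = diag k + isLe (tri (suc (diag k))) (suc k)

diagonal : Computable₁ (λ _ → diag)
diagonal = recursion₁ diag 0 (λ k r → r + isLe (tri (suc r)) (suc k))
  (compose₂ addition second
     (compose₂ isLe-computable (compose₁ triangular (compose₁ successor second)) (compose₁ successor first)))
  refl λ _ → refl

tri-mono : ∀ {s t} → s ≤ t → tri s ≤ tri t
tri-mono z≤n     = z≤n
tri-mono (s≤s h) = +-mono-≤ (s≤s h) (tri-mono h)

diag-onDiagonal : ∀ n → OnDiagonal (diag n) n
diag-onDiagonal zero = z≤n , s≤s z≤n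
diag-onDiagonal (suc n) with diag-onDiagonal n | tri (suc (diag n)) ≤? suc n
... | _ , n<next | yes next≤ =
  subst (λ d → OnDiagonal d (suc n)) (sym (trans (cong (diag n +_) (isLe-≤ next≤)) (+-comm (diag n) 1)))
        (next≤ , ≤-<-trans n<next (m<n+m (tri (suc (diag n))) {suc (suc (diag n))} z<s))
... | start≤ , _ | no next≰ =
  subst (λ d → OnDiagonal d (suc n)) (sym (trans (cong (diag n +_) (isLe-> (≰⇒> next≰))) (+-identityʳ (diag n))))
        (≤-trans start≤ (n≤1+n n) , ≰⇒> next≰)

onDiagonal-unique : ∀ {s t n} → OnDiagonal s n → OnDiagonal t n → s ≡ t
onDiagonal-unique i j = ≤-antisym (≮⇒≥ (below j i)) (≮⇒≥ (below i j))
  where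
  below : ∀ {s t n} → OnDiagonal s n → OnDiagonal t n → ¬ s < t
  below (_ , n<) (t≤ , _) s<t = <⇒≱ n< (≤-trans (tri-mono s<t) t≤)

pair-onDiagonal : ∀ a b → OnDiagonal (a + b) ⟨ a , b ⟩
pair-onDiagonal a b = m≤m+n (tri (a + b)) b ,
  s≤s (≤-trans (+-monoʳ-≤ (tri (a + b)) (m≤n+m b a)) (≤-reflexive (+-comm (tri (a + b)) (a + b))))

snd : ℕ → ℕ
snd n = n ∸ tri (diag n)

fst : ℕ → ℕ
fst n = diag n ∸ snd n

second-component : Computable₁ (λ _ → snd)
second-component = compose₂ subtraction identity (compose₁ triangular diagonal)

first-component : Computable₁ (λ _ → fst)
first-component = compose₂ subtraction diagonal second-component

diag-pair : ∀ a b → diag ⟨ a , b ⟩ ≡ a + b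
diag-pair a b = onDiagonal-unique (diag-onDiagonal ⟨ a , b ⟩) (pair-onDiagonal a b)

snd-pair : ∀ a b → snd ⟨ a , b ⟩ ≡ b
snd-pair a b rewrite diag-pair a b = m+n∸m≡n (tri (a + b)) b

fst-pair : ∀ a b → fst ⟨ a , b ⟩ ≡ a
fst-pair a b rewrite snd-pair a b | diag-pair a b = m+n∸n≡m a b

pair-fst-snd : ∀ n → ⟨ fst n , snd n ⟩ ≡ n
pair-fst-snd n = begin
  tri (fst n + snd n) + snd n  ≡⟨ cong (λ d → tri d + snd n) (m∸n+n≡m snd≤diag) ⟩
  tri (diag n) + snd n         ≡⟨ m+[n∸m]≡n start≤ ⟩
  n                            ∎
  where
  open ≡-Reasoning
  start≤ : tri (diag n) ≤ n
  start≤ = proj₁ (diag-onDiagonal n)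
  snd≤diag : snd n ≤ diag n
  snd≤diag = s≤s⁻¹ (m<n+o⇒m∸n<o n (tri (diag n))
               (subst (n <_) (+-comm (suc (diag n)) (tri (diag n))) (proj₂ (diag-onDiagonal n))))

-- The disjoint union of the graphs named by the components of p.  Vertex
-- ⟨i,v⟩ is v in G_i; the edge code ⟨u,w⟩ is an edge iff u, w lie in the same
-- summand i and are adjacent there.
unionVertex : Baire → ℕ → ℕ
unionVertex p w = component p (fst w) (2 * snd w)

unionEdge : Baire → ℕ → ℕ
unionEdge p e =
  isEq (fst (fst e)) (fst (snd e)) * component p (fst (fst e)) (suc (2 * ⟨ snd (fst e) , snd (snd e) ⟩))

union : Baire → Baire
union p n = select (par n) (unionVertex p (half n)) (unionEdge p (half n))

union-computable : Computable₁ union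
union-computable = selection parity (compose₁ vertex halving) (compose₁ edge halving)
  where
  vertex : Computable₁ unionVertex
  vertex = compose₁ oracle (compose₂ pairing first-component (compose₁ doubling second-component))
  edge : Computable₁ unionEdge
  edge = compose₂ multiplication
    (compose₂ isEq-computable (compose₁ first-component first-component) (compose₁ first-component second-component))
    (compose₁ oracle (compose₂ pairing (compose₁ first-component first-component)
       (compose₁ successor (compose₁ doubling
          (compose₂ pairing (compose₁ second-component first-component) (compose₁ second-component second-component))))))

union-vertex : ∀ p w → union p (2 * w) ≡ unionVertex p w
union-vertex p w rewrite par-even w | half-even w = select-0 _ (unionEdge p w)

union-edge : ∀ p u w →
  union p (suc (2 * ⟨ u , w ⟩)) ≡ isEq (fst u) (fst w) * component p (fst u) (suc (2 * ⟨ snd u , snd w ⟩))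
union-edge p u w rewrite par-odd ⟨ u , w ⟩ | half-odd ⟨ u , w ⟩ | fst-pair u w | snd-pair u w = select-1 (unionVertex p ⟨ u , w ⟩) _

union-edge-pair : ∀ p i a j b →
  union p (suc (2 * ⟨ ⟨ i , a ⟩ , ⟨ j , b ⟩ ⟩)) ≡ isEq i j * component p i (suc (2 * ⟨ a , b ⟩))
union-edge-pair p i a j b
  rewrite union-edge p ⟨ i , a ⟩ ⟨ j , b ⟩ | fst-pair i a | snd-pair i a | fst-pair j b | snd-pair j b = refl

union-InE→ : ∀ p u w → InE (union p) u w → fst u ≡ fst w × InE (component p (fst u)) (snd u) (snd w)
union-InE→ p u w h = guarded-sound _ _ _ (trans (sym (union-edge p u w)) h)

union-InE← : ∀ p u w → fst u ≡ fst w → InE (component p (fst u)) (snd u) (snd w) → InE (union p) u w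
union-InE← p u w same h =
  trans (union-edge p u w) (subst (λ j → isEq (fst u) j * component p (fst u) (suc (2 * ⟨ snd u , snd w ⟩)) ≡ 1) same (guarded-complete (fst u) _ h))

union-InE-pair→ : ∀ p i a b → InE (union p) ⟨ i , a ⟩ ⟨ i , b ⟩ → InE (component p i) a b
union-InE-pair→ p i a b h = proj₂ (guarded-sound i i _ (trans (sym (union-edge-pair p i a i b)) h))

union-InE-pair← : ∀ p i a b → InE (component p i) a b → InE (union p) ⟨ i , a ⟩ ⟨ i , b ⟩
union-InE-pair← p i a b h = trans (union-edge-pair p i a i b) (guarded-complete i _ h)

union-bipartite : ∀ p → (∀ i → IsBipartiteGraph (component p i)) → IsBipartiteGraph (union p)
union-bipartite p graphs = endpoints , symmetric , colour , proper
  where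
  colourOf : ℕ → ℕ → Bool
  colourOf i = proj₁ (proj₂ (proj₂ (graphs i)))

  endpoints : ∀ u w → InE (union p) u w → InV (union p) u × InV (union p) w
  endpoints u w h with union-InE→ p u w h
  ... | same , h' = trans (union-vertex p u) (proj₁ ends) ,
                    trans (union-vertex p w) (subst (λ i → InV (component p i) (snd w)) same (proj₂ ends))
    where
    ends : InV (component p (fst u)) (snd u) × InV (component p (fst u)) (snd w)
    ends = proj₁ (graphs (fst u)) (snd u) (snd w) h'

  symmetric : ∀ u w → InE (union p) u w → InE (union p) w u
  symmetric u w h with union-InE→ p u w h
  ... | same , h' = union-InE← p w u (sym same)
    (subst (λ i → InE (component p i) (snd w) (snd u)) same (proj₁ (proj₂ (graphs (fst u))) (snd u) (snd w) h'))

  colour : ℕ → Bool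
  colour w = colourOf (fst w) (snd w)

  proper : ∀ u w → InE (union p) u w → colour u ≢ colour w
  proper u w h with union-InE→ p u w h
  ... | same , h' = subst (λ i → colourOf (fst u) (snd u) ≢ colourOf i (snd w)) same
                          (proj₂ (proj₂ (proj₂ (graphs (fst u)))) (snd u) (snd w) h')

-- From p ⊕ q, where q names sets of vertices and edges of the union, the
-- sequence of their restrictions to the summands: component i has vertex v
-- iff q has ⟨i,v⟩, and edge (a,b) iff q has (⟨i,a⟩,⟨i,b⟩).
right : Baire → Baire
right o m = o (suc (2 * m))

restrictVertex : Baire → ℕ → ℕ → ℕ
restrictVertex o i v = right o (2 * ⟨ i , v ⟩)

restrictEdge : Baire → ℕ → ℕ → ℕ
restrictEdge o i e = right o (suc (2 * ⟨ ⟨ i , fst e ⟩ , ⟨ i , snd e ⟩ ⟩))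

restrict : Baire → Baire
restrict o n = select (par (snd n)) (restrictVertex o (fst n) (half (snd n)))
                                    (restrictEdge o (fst n) (half (snd n)))

restrict-computable : Computable₁ restrict
restrict-computable = selection (compose₁ parity second-component) vertex edge
  where
  rightHalf : Computable₁ right
  rightHalf = compose₁ oracle (compose₁ successor doubling)
  halfK : Computable₁ (λ _ n → half (snd n))
  halfK = compose₁ halving second-component
  vertex : Computable₁ (λ o n → restrictVertex o (fst n) (half (snd n)))
  vertex = compose₁ rightHalf (compose₁ doubling (compose₂ pairing first-component halfK))
  edge : Computable₁ (λ o n → restrictEdge o (fst n) (half (snd n)))
  edge = compose₁ rightHalf (compose₁ successor (compose₁ doubling
           (compose₂ pairing (compose₂ pairing first-component (compose₁ first-component halfK))
                             (compose₂ pairing first-component (compose₁ second-component halfK)))))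

restrict-vertex : ∀ p q i v → restrict (p ⊕ q) ⟨ i , 2 * v ⟩ ≡ q (2 * ⟨ i , v ⟩)
restrict-vertex p q i v rewrite fst-pair i (2 * v) | snd-pair i (2 * v) | par-even v | half-even v =
  trans (select-0 _ (restrictEdge (p ⊕ q) i v)) (⊕-odd p q _)

restrict-edge : ∀ p q i a b → restrict (p ⊕ q) ⟨ i , suc (2 * ⟨ a , b ⟩) ⟩ ≡ q (suc (2 * ⟨ ⟨ i , a ⟩ , ⟨ i , b ⟩ ⟩))
restrict-edge p q i a b
  rewrite fst-pair i (suc (2 * ⟨ a , b ⟩)) | snd-pair i (suc (2 * ⟨ a , b ⟩))
        | par-odd ⟨ a , b ⟩ | half-odd ⟨ a , b ⟩ | fst-pair a b | snd-pair a b =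
  trans (select-1 (restrictVertex (p ⊕ q) i ⟨ a , b ⟩) _) (⊕-odd p q _)

restrict-cover : ∀ p q → IsKonigCover (union p) q →
                 ∀ i → IsKonigCover (component p i) (component (restrict (p ⊕ q)) i)
restrict-cover p q (inG , symM , matching , oneEnd , chosen , covers) i =
  inGᵢ , symMᵢ , matchingᵢ , oneEndᵢ , chosenᵢ , coversᵢ
  where
  Gᵢ S : Baire
  Gᵢ = component p i
  S = component (restrict (p ⊕ q)) i

  V→ : ∀ v → InV S v → InV q ⟨ i , v ⟩
  V→ v = trans (sym (restrict-vertex p q i v))
  V← : ∀ v → InV q ⟨ i , v ⟩ → InV S v
  V← v = trans (restrict-vertex p q i v)
  E→ : ∀ a b → InE S a b → InE q ⟨ i , a ⟩ ⟨ i , b ⟩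
  E→ a b = trans (sym (restrict-edge p q i a b))
  E← : ∀ a b → InE q ⟨ i , a ⟩ ⟨ i , b ⟩ → InE S a b
  E← a b = trans (restrict-edge p q i a b)

  inGᵢ : ∀ a b → InE S a b → InE Gᵢ a b
  inGᵢ a b h = union-InE-pair→ p i a b (inG ⟨ i , a ⟩ ⟨ i , b ⟩ (E→ a b h))

  symMᵢ : ∀ a b → InE S a b → InE S b a
  symMᵢ a b h = E← b a (symM ⟨ i , a ⟩ ⟨ i , b ⟩ (E→ a b h))

  matchingᵢ : ∀ a b c → InE S a b → InE S a c → b ≡ c
  matchingᵢ a b c h h' =
    trans (sym (snd-pair i b)) (trans (cong snd (matching ⟨ i , a ⟩ ⟨ i , b ⟩ ⟨ i , c ⟩ (E→ a b h) (E→ a c h'))) (snd-pair i c))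

  oneEndᵢ : ∀ a b → InE S a b → (InV S a × ¬ InV S b) ⊎ (¬ InV S a × InV S b)
  oneEndᵢ a b h with oneEnd ⟨ i , a ⟩ ⟨ i , b ⟩ (E→ a b h)
  ... | inj₁ (inA , outB) = inj₁ (V← a inA , λ inB → outB (V→ b inB))
  ... | inj₂ (outA , inB) = inj₂ ((λ inA → outA (V→ a inA)) , V← b inB)

  -- The matching partner of a chosen vertex ⟨i,c⟩ lies in the same summand.
  chosenᵢ : ∀ c → InV S c → ∃ λ b → InE S c b
  chosenᵢ c h with chosen ⟨ i , c ⟩ (V→ c h)
  ... | w , e = snd w , E← c (snd w) (subst (InE q ⟨ i , c ⟩) w≡ e)
    where
    sameSummand : i ≡ fst w
    sameSummand = trans (sym (fst-pair i c)) (proj₁ (union-InE→ p ⟨ i , c ⟩ w (inG ⟨ i , c ⟩ w e)))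
    w≡ : w ≡ ⟨ i , snd w ⟩
    w≡ = trans (sym (pair-fst-snd w)) (cong (λ j → ⟨ j , snd w ⟩) (sym sameSummand))

  coversᵢ : ∀ a b → InE Gᵢ a b → InV S a ⊎ InV S b
  coversᵢ a b h with covers ⟨ i , a ⟩ ⟨ i , b ⟩ (union-InE-pair← p i a b h)
  ... | inj₁ inA = inj₁ (V← a inA)
  ... | inj₂ inB = inj₂ (V← b inB)

proposition9p4 : parallel KDT ≤W KDT
proposition9p4 =
  proj₁ union-computable , proj₁ restrict-computable ,
  λ p graphs → union p , computes union union-computable p , union-bipartite p graphs ,
    λ q cover → restrict (p ⊕ q) , computes restrict restrict-computable (p ⊕ q) , restrict-cover p q cover
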